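{- Let $a$ be a positive integer and $n\ge1$. Then the word $u=a^n$ (the letter $a$ repeated $n$ times) is strongly stable: $C(u^k)=C(u)$ for all $k\ge1$.
   Context: Juxtaposition denotes concatenation of words and $u^k$ denotes $u$ concatenated with itself $k$ times. $P(w)$ is the insertion tableau of $w$ under the Robinson–Schensted–Knuth (row-insertion) correspondence, and $C(u)=\{w : P(uw)=P(wu)\}$. -}

module Defs where

open import Data.Nat using (ℕ; zero; suc; _≤_; _<?_)
open import Data.List using (List; []; _∷_; _++_; foldl)
open import Data.Maybe using (Maybe; just; nothing)
open import Data.Product using (_×_; _,_)
open import Relation.Nullary using (yes; no)

-- Words over the alphabet of positive integers are represented as lists of
-- natural numbers; positivity of letters is imposed separately via `Positive`.
Word : Set
Word = List ℕ

data Positive : Word → Set where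
  []  : Positive []
  _∷_ : ∀ {x w} → 1 ≤ x → Positive w → Positive (x ∷ w)

-- A (semistandard Young) tableau as a list of rows, top row first;
-- each row is weakly increasing left to right.
Tableau : Set
Tableau = List (List ℕ)

rowInsert : ℕ → List ℕ → List ℕ × Maybe ℕ
rowInsert x [] = (x ∷ [] , nothing)
rowInsert x (y ∷ ys) with x <? y
... | yes _ = (x ∷ ys , just y)
... | no _ with rowInsert x ys
...   | (ys' , b) = (y ∷ ys' , b)

insert : ℕ → Tableau → Tableau
insert x [] = (x ∷ []) ∷ []
insert x (r ∷ rs) with rowInsert x r
... | (r' , nothing) = r' ∷ rs
... | (r' , just y)  = r' ∷ insert y rs

P : Word → Tableau
P w = foldl (λ T x → insert x T) [] w

_^ʷ_ : Word → ℕ → Word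
u ^ʷ zero = []
u ^ʷ suc k = u ++ (u ^ʷ k)

_∈C_ : Word → Word → Set
w ∈C u = P (u ++ w) ≡ P (w ++ u)
  where open import Relation.Binary.PropositionalEquality using (_≡_)

{-# OPTIONS --safe #-}
-- Write the first row of a tableau as S aᶜ B with S < a < B.  A letter x < a
-- is inserted into S and, if it bumps nothing there, it replaces the first a
-- (or, when c = 0, the head of B); a letter a increases c and bumps the head of
-- B; a letter x > a only changes B.  So the first row of P(w aᵐ) is S a^(c+m)
-- followed by B without its first m letters, and those m letters are all that
-- is bumped further.  Inserting w after aᵐ runs the same process from c = m
-- instead of c = 0.  The two runs stay m copies of a apart until a letter x < a
-- is appended to S while the unpadded run has c = 0; from then on the padded
-- run holds fewer than c + m copies.  Hence w ∈ C(aᵐ) iff that never happens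
-- and the first row of P(w) has no letter > a, a condition independent of m ≥ 1.
module Submission where

open import Defs
open import Data.Nat using (ℕ; _≤_)
open import Data.List using (List; [_])
open import Function.Bundles using (_⇔_)

open import Data.Nat using (zero; suc; _+_; _*_; _<_; _<?_; _≟_; z≤n; s≤s; s<s; NonZero; >-nonZero⁻¹)
open import Data.Nat.Properties
  using ( <-cmp; <-irrefl; <-trans; <-≤-trans; <⇒≤; ≤⇒≯; ≮⇒≥; ≤-refl; n<1+n; m≤n+m
        ; +-suc; +-identityʳ; 1+n≰n; m∸n≤m)
open import Data.List using ([]; _∷_; _++_; foldl; replicate; drop; head; fromMaybe; length)
open import Data.List.Properties
  using ( ++-assoc; ++-identityʳ; ++-cancelˡ; foldl-++; drop-[]; drop-drop; length-drop
        ; ∷-injectiveˡ; ∷-injectiveʳ)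
open import Data.List.Relation.Unary.All as All using (All; []; _∷_)
open import Data.List.Relation.Unary.All.Properties using (drop⁺; replicate⁺; ++⁺)
open import Data.Maybe using (Maybe; just; nothing)
open import Data.Maybe.Properties using (≡-dec)
open import Data.Product using (_×_; _,_; proj₁; proj₂; map₁)
open import Data.Sum as Sum using (_⊎_; inj₁; inj₂)
open import Relation.Nullary using (¬_; Dec; yes; no; contradiction)
open import Relation.Nullary.Decidable using (_×-dec_)
open import Relation.Binary.PropositionalEquality
  using (_≡_; _≢_; refl; sym; trans; cong; cong₂; subst; subst₂; module ≡-Reasoning)
open import Relation.Binary.Definitions using (tri<; tri≈; tri>)
open import Function.Bundles using (mk⇔)
import Function.Properties.Equivalence as ⇔

open ≡-Reasoning

replicate-++ : ∀ {A : Set} m n (x : A) → replicate m x ++ replicate n x ≡ replicate (m + n) x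
replicate-++ zero    n x = refl
replicate-++ (suc m) n x = cong (x ∷_) (replicate-++ m n x)

replicate-++-∷ : ∀ {A : Set} m (x : A) xs → replicate m x ++ x ∷ xs ≡ x ∷ replicate m x ++ xs
replicate-++-∷ zero    x xs = refl
replicate-++-∷ (suc m) x xs = cong (x ∷_) (replicate-++-∷ m x xs)

singleton-^ʷ : ∀ x n → [ x ] ^ʷ n ≡ replicate n x
singleton-^ʷ x zero    = refl
singleton-^ʷ x (suc n) = cong (x ∷_) (singleton-^ʷ x n)

replicate-^ʷ : ∀ x n k → replicate n x ^ʷ k ≡ replicate (k * n) x
replicate-^ʷ x n zero    = refl
replicate-^ʷ x n (suc k) =
  trans (cong (replicate n x ++_) (replicate-^ʷ x n k)) (replicate-++ n (k * n) x)

replicate-++-injective : ∀ {x} c d {ys zs} → All (x <_) ys → All (x <_) zs →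
                         replicate c x ++ ys ≡ replicate d x ++ zs → c ≡ d
replicate-++-injective zero    zero    _         _         _ = refl
replicate-++-injective zero    (suc d) (x<y ∷ _) _         e =
  contradiction (subst (_ <_) (∷-injectiveˡ e) x<y) (<-irrefl refl)
replicate-++-injective (suc c) zero    _         (x<z ∷ _) e =
  contradiction (subst (_ <_) (sym (∷-injectiveˡ e)) x<z) (<-irrefl refl)
replicate-++-injective (suc c) (suc d) x<ys      x<zs      e =
  cong suc (replicate-++-injective c d x<ys x<zs (∷-injectiveʳ e))

≡drop-suc⇒[] : ∀ {A : Set} m (xs : List A) → xs ≡ drop (suc m) xs → xs ≡ []
≡drop-suc⇒[] m []       _ = refl
≡drop-suc⇒[] m (x ∷ xs) e =
  contradiction (subst (_≤ length xs) (sym (trans (cong length e) (length-drop m xs))) (m∸n≤m (length xs) m))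
                1+n≰n

insertAll : Tableau → Word → Tableau
insertAll = foldl (λ T x → insert x T)

insert-∷ : ∀ x r T →
           insert x (r ∷ T) ≡ proj₁ (rowInsert x r) ∷ insertAll T (fromMaybe (proj₂ (rowInsert x r)))
insert-∷ x r T with rowInsert x r
... | (r′ , nothing) = refl
... | (r′ , just y)  = refl

All-rowInsert : ∀ {Q : ℕ → Set} {x} r → Q x → All Q r → All Q (proj₁ (rowInsert x r))
All-rowInsert []      qx []         = qx ∷ []
All-rowInsert {x = x} (y ∷ r) qx (qy ∷ qr) with x <? y
... | yes _ = qx ∷ qr
... | no  _ = qy ∷ All-rowInsert r qx qr

-- In the `no` branches of the next two lemmas, η for pairs turns e into a statement about rowInsert x r.
rowInsert-nothing⇒All≤ : ∀ {x} r → proj₂ (rowInsert x r) ≡ nothing → All (_≤ x) r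
rowInsert-nothing⇒All≤ []      _ = []
rowInsert-nothing⇒All≤ {x} (y ∷ r) e with x <? y
rowInsert-nothing⇒All≤ {x} (y ∷ r) () | yes _
... | no x≮y = ≮⇒≥ x≮y ∷ rowInsert-nothing⇒All≤ r e

rowInsert-++-just : ∀ {x y} r s → proj₂ (rowInsert x r) ≡ just y →
                    rowInsert x (r ++ s) ≡ map₁ (_++ s) (rowInsert x r)
rowInsert-++-just [] s ()
rowInsert-++-just {x} (z ∷ r) s e with x <? z
... | yes _ = refl
... | no  _ = cong (map₁ (z ∷_)) (rowInsert-++-just r s e)

rowInsert-All≤ : ∀ {x} r → All (_≤ x) r → rowInsert x r ≡ (r ++ [ x ] , nothing)
rowInsert-All≤ []      []          = refl
rowInsert-All≤ {x} (y ∷ r) (y≤x ∷ r≤x) with x <? y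
... | yes x<y = contradiction x<y (≤⇒≯ y≤x)
... | no  _   rewrite rowInsert-All≤ r r≤x = refl

rowInsert-All> : ∀ {x} r → All (x <_) r → rowInsert x r ≡ (x ∷ drop 1 r , head r)
rowInsert-All> []      []          = refl
rowInsert-All> {x} (y ∷ r) (x<y ∷ _) with x <? y
... | yes _   = refl
... | no  x≮y = contradiction x<y x≮y

rowInsert-++-All≤ : ∀ {x} r s → All (_≤ x) r → rowInsert x (r ++ s) ≡ map₁ (r ++_) (rowInsert x s)
rowInsert-++-All≤ []      s []          = refl
rowInsert-++-All≤ {x} (y ∷ r) s (y≤x ∷ r≤x) with x <? y
... | yes x<y = contradiction x<y (≤⇒≯ y≤x)
... | no  _   rewrite rowInsert-++-All≤ r s r≤x = refl

module FirstRow (a : ℕ) where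

  record Split : Set where
    constructor split
    field
      small : List ℕ
      count : ℕ
      large : List ℕ
  open Split

  row : Split → List ℕ
  row (split S c B) = S ++ replicate c a ++ B

  WellSplit : Split → Set
  WellSplit t = All (_< a) (small t) × All (a <_) (large t)

  afterSmall : List ℕ × Maybe ℕ → ℕ → List ℕ → Split × Maybe ℕ
  afterSmall (S , just y)  c       B = split S c B , just y
  afterSmall (S , nothing) (suc c) B = split S c B , just a
  afterSmall (S , nothing) zero    B = split S zero (drop 1 B) , head B

  step : ℕ → Split → Split × Maybe ℕ
  step x (split S c B) with <-cmp x a
  ... | tri< _ _ _ = afterSmall (rowInsert x S) c B
  ... | tri≈ _ _ _ = split S (suc c) (drop 1 B) , head B
  ... | tri> _ _ _ = map₁ (split S c) (rowInsert x B)

  step-a : ∀ S c B → step a (split S c B) ≡ (split S (suc c) (drop 1 B) , head B)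
  step-a S c B with <-cmp a a
  ... | tri< a<a _ _ = contradiction a<a (<-irrefl refl)
  ... | tri≈ _ _ _   = refl
  ... | tri> _ _ a>a = contradiction a>a (<-irrefl refl)

  afterSmall-WellSplit : ∀ p c B → All (_< a) (proj₁ p) → All (a <_) B →
                         WellSplit (proj₁ (afterSmall p c B))
  afterSmall-WellSplit (S , just _)  c       B S<a a<B = S<a , a<B
  afterSmall-WellSplit (S , nothing) (suc c) B S<a a<B = S<a , a<B
  afterSmall-WellSplit (S , nothing) zero    B S<a a<B = S<a , drop⁺ 1 a<B

  step-WellSplit : ∀ x t → WellSplit t → WellSplit (proj₁ (step x t))
  step-WellSplit x (split S c B) (S<a , a<B) with <-cmp x a
  ... | tri< x<a _ _ = afterSmall-WellSplit (rowInsert x S) c B (All-rowInsert S x<a S<a) a<B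
  ... | tri≈ _ _ _   = S<a , drop⁺ 1 a<B
  ... | tri> _ _ a<x = S<a , All-rowInsert B a<x a<B

  afterSmall-nothing : ∀ S c B → map₁ row (afterSmall (S , nothing) c B) ≡
                                 (S ++ drop 1 (replicate c a ++ B) , head (replicate c a ++ B))
  afterSmall-nothing S (suc c) B = refl
  afterSmall-nothing S zero    B = refl

  rowInsert-row-small : ∀ {x} → x < a → ∀ S c B → All (a <_) B →
                        rowInsert x (S ++ replicate c a ++ B) ≡ map₁ row (afterSmall (rowInsert x S) c B)
  rowInsert-row-small {x} x<a S c B a<B with rowInsert x S in eq
  ... | (S′ , just y)  = trans (rowInsert-++-just S L (cong proj₂ eq)) (cong (map₁ (_++ L)) eq)
    where L = replicate c a ++ B
  ... | (S′ , nothing) = begin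
    rowInsert x (S ++ L)                      ≡⟨ rowInsert-++-All≤ S L S≤x ⟩
    map₁ (S ++_) (rowInsert x L)              ≡⟨ cong (map₁ (S ++_)) (rowInsert-All> L x<L) ⟩
    (S ++ x ∷ drop 1 L , head L)              ≡⟨ cong (_, head L) (sym (++-assoc S [ x ] (drop 1 L))) ⟩
    ((S ++ [ x ]) ++ drop 1 L , head L)       ≡⟨ cong (λ r → r ++ drop 1 L , head L) S++x≡S′ ⟩
    (S′ ++ drop 1 L , head L)                 ≡⟨ sym (afterSmall-nothing S′ c B) ⟩
    map₁ row (afterSmall (S′ , nothing) c B)  ∎
    where
    L = replicate c a ++ B
    S≤x : All (_≤ x) S
    S≤x = rowInsert-nothing⇒All≤ S (cong proj₂ eq)
    S++x≡S′ : S ++ [ x ] ≡ S′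
    S++x≡S′ = cong proj₁ (trans (sym (rowInsert-All≤ S S≤x)) eq)
    x<L : All (x <_) L
    x<L = ++⁺ (replicate⁺ c x<a) (All.map (<-trans x<a) a<B)

  rowInsert-row : ∀ x t → WellSplit t → rowInsert x (row t) ≡ map₁ row (step x t)
  rowInsert-row x (split S c B) (S<a , a<B) with <-cmp x a
  ... | tri< x<a _ _  = rowInsert-row-small x<a S c B a<B
  ... | tri≈ _ refl _ = begin
    rowInsert a (S ++ replicate c a ++ B)
      ≡⟨ rowInsert-++-All≤ S _ (All.map <⇒≤ S<a) ⟩
    map₁ (S ++_) (rowInsert a (replicate c a ++ B))
      ≡⟨ cong (map₁ (S ++_)) (rowInsert-++-All≤ (replicate c a) B (replicate⁺ c ≤-refl)) ⟩
    map₁ (λ r → S ++ replicate c a ++ r) (rowInsert a B)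
      ≡⟨ cong (map₁ (λ r → S ++ replicate c a ++ r)) (rowInsert-All> B a<B) ⟩
    (S ++ replicate c a ++ a ∷ drop 1 B , head B)
      ≡⟨ cong (λ r → S ++ r , head B) (replicate-++-∷ c a (drop 1 B)) ⟩
    (S ++ a ∷ replicate c a ++ drop 1 B , head B) ∎
  ... | tri> _ _ a<x  = begin
    rowInsert x (S ++ replicate c a ++ B)
      ≡⟨ rowInsert-++-All≤ S _ (All.map (λ y<a → <⇒≤ (<-trans y<a a<x)) S<a) ⟩
    map₁ (S ++_) (rowInsert x (replicate c a ++ B))
      ≡⟨ cong (map₁ (S ++_)) (rowInsert-++-All≤ (replicate c a) B (replicate⁺ c (<⇒≤ a<x))) ⟩
    map₁ (λ r → S ++ replicate c a ++ r) (rowInsert x B) ∎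

  run : Split → Word → Split
  run = foldl (λ t x → proj₁ (step x t))

  bumped : Split → Word → Word
  bumped t []      = []
  bumped t (x ∷ v) = fromMaybe (proj₂ (step x t)) ++ bumped (proj₁ (step x t)) v

  bumped-++ : ∀ t u v → bumped t (u ++ v) ≡ bumped t u ++ bumped (run t u) v
  bumped-++ t []      v = refl
  bumped-++ t (x ∷ u) v = begin
    fromMaybe b ++ bumped t′ (u ++ v)                    ≡⟨ cong (fromMaybe b ++_) (bumped-++ t′ u v) ⟩
    fromMaybe b ++ bumped t′ u ++ bumped (run t′ u) v    ≡⟨ sym (++-assoc (fromMaybe b) _ _) ⟩
    (fromMaybe b ++ bumped t′ u) ++ bumped (run t′ u) v  ∎
    where
    t′ = proj₁ (step x t)
    b  = proj₂ (step x t)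

  run-WellSplit : ∀ v t → WellSplit t → WellSplit (run t v)
  run-WellSplit []      t wt = wt
  run-WellSplit (x ∷ v) t wt = run-WellSplit v _ (step-WellSplit x t wt)

  insertAll-row : ∀ t T v → WellSplit t → insertAll (row t ∷ T) v ≡ row (run t v) ∷ insertAll T (bumped t v)
  insertAll-row t T []      _  = refl
  insertAll-row t T (x ∷ v) wt = begin
    insertAll (insert x (row t ∷ T)) v
      ≡⟨ cong (λ T′ → insertAll T′ v) (insert-∷ x (row t) T) ⟩
    insertAll (proj₁ (rowInsert x (row t)) ∷ insertAll T (fromMaybe (proj₂ (rowInsert x (row t))))) v
      ≡⟨ cong (λ p → insertAll (proj₁ p ∷ insertAll T (fromMaybe (proj₂ p))) v) (rowInsert-row x t wt) ⟩
    insertAll (row t′ ∷ insertAll T (fromMaybe b)) v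
      ≡⟨ insertAll-row t′ _ v (step-WellSplit x t wt) ⟩
    row (run t′ v) ∷ insertAll (insertAll T (fromMaybe b)) (bumped t′ v)
      ≡⟨ cong (row (run t′ v) ∷_) (sym (foldl-++ _ T (fromMaybe b) (bumped t′ v))) ⟩
    row (run t′ v) ∷ insertAll T (fromMaybe b ++ bumped t′ v) ∎
    where
    t′ = proj₁ (step x t)
    b  = proj₂ (step x t)

  t₀ : Split
  t₀ = split [] 0 []

  -- Inserting x into the empty tableau and into the tableau [[]] give the same result.
  P-∷ : ∀ x v → P (x ∷ v) ≡ row (run t₀ (x ∷ v)) ∷ P (bumped t₀ (x ∷ v))
  P-∷ x v = insertAll-row t₀ [] (x ∷ v) ([] , [])

  P-++-∷ : ∀ u x v → P (u ++ x ∷ v) ≡ row (run t₀ (u ++ x ∷ v)) ∷ P (bumped t₀ (u ++ x ∷ v))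
  P-++-∷ []      x v = P-∷ x v
  P-++-∷ (y ∷ u) x v = P-∷ y (u ++ x ∷ v)

  addCopies : ℕ → Split → Split
  addCopies m (split S c B) = split S (c + m) B

  run-replicate : ∀ m S c B → run (split S c B) (replicate m a) ≡ split S (c + m) (drop m B)
  run-replicate zero    S c B = cong (λ c′ → split S c′ B) (sym (+-identityʳ c))
  run-replicate (suc m) S c B = begin
    run (proj₁ (step a (split S c B))) (replicate m a)
      ≡⟨ cong (λ p → run (proj₁ p) (replicate m a)) (step-a S c B) ⟩
    run (split S (suc c) (drop 1 B)) (replicate m a)
      ≡⟨ run-replicate m S (suc c) (drop 1 B) ⟩
    split S (suc c + m) (drop m (drop 1 B))
      ≡⟨ cong₂ (split S) (sym (+-suc c m)) (drop-drop 1 m B) ⟩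
    split S (c + suc m) (drop (suc m) B) ∎

  bumped-replicate-[] : ∀ m S c → bumped (split S c []) (replicate m a) ≡ []
  bumped-replicate-[] zero    S c = refl
  bumped-replicate-[] (suc m) S c =
    trans (cong (λ p → fromMaybe (proj₂ p) ++ bumped (proj₁ p) (replicate m a)) (step-a S c []))
          (bumped-replicate-[] m S (suc c))

  large≡[]⇒run-replicate : ∀ m {t} → large t ≡ [] →
                           run t (replicate m a) ≡ addCopies m t × bumped t (replicate m a) ≡ []
  large≡[]⇒run-replicate m {split S c .[]} refl =
    trans (run-replicate m S c []) (cong (split S (c + m)) (drop-[] m)) , bumped-replicate-[] m S c

  P-replicate-++ : ∀ m w → let t = addCopies (suc m) t₀ in
                   P (replicate (suc m) a ++ w) ≡ row (run t w) ∷ P (bumped t w)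
  P-replicate-++ m w = begin
    P (u ++ w)
      ≡⟨ P-∷ a (replicate m a ++ w) ⟩
    row (run t₀ (u ++ w)) ∷ P (bumped t₀ (u ++ w))
      ≡⟨ cong₂ (λ t v → row t ∷ P v) (foldl-++ _ t₀ u w) (bumped-++ t₀ u w) ⟩
    row (run (run t₀ u) w) ∷ P (bumped t₀ u ++ bumped (run t₀ u) w)
      ≡⟨ cong₂ (λ t v → row (run t w) ∷ P (v ++ bumped t w))
               (run-replicate (suc m) [] 0 []) (bumped-replicate-[] (suc m) [] 0) ⟩
    row (run (addCopies (suc m) t₀) w) ∷ P (bumped (addCopies (suc m) t₀) w) ∎
    where
    u = replicate (suc m) a

  P-++-replicate : ∀ m w → let u = replicate (suc m) a ; tw = run t₀ w in
                   P (w ++ u) ≡ row (run tw u) ∷ P (bumped t₀ w ++ bumped tw u)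
  P-++-replicate m w =
    trans (P-++-∷ w a (replicate m a)) (cong₂ (λ t v → row t ∷ P v) (foldl-++ _ t₀ w u) (bumped-++ t₀ w u))
    where
    u = replicate (suc m) a

  -- The runs from t and from addCopies m t can only separate at such a step: x is
  -- appended to the small part of t, which has no copy of a, so in t it bumps the
  -- head of the large part while in addCopies m t it bumps an a.
  Diverges : ℕ → Split → Set
  Diverges x t = x < a × proj₂ (rowInsert x (small t)) ≡ nothing × count t ≡ 0

  diverges? : ∀ x t → Dec (Diverges x t)
  diverges? x t = x <? a ×-dec ≡-dec _≟_ (proj₂ (rowInsert x (small t))) nothing ×-dec count t ≟ 0

  data NeverDiverges : Split → Word → Set where
    []  : ∀ {t} → NeverDiverges t []
    _∷_ : ∀ {t x v} → ¬ Diverges x t → NeverDiverges (proj₁ (step x t)) v → NeverDiverges t (x ∷ v)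

  afterSmall-addCopies : ∀ m p c B → ¬ (proj₂ p ≡ nothing × c ≡ 0) →
                         afterSmall p (c + m) B ≡ map₁ (addCopies m) (afterSmall p c B)
  afterSmall-addCopies m (S , just y)  c       B _    = refl
  afterSmall-addCopies m (S , nothing) (suc c) B _    = refl
  afterSmall-addCopies m (S , nothing) zero    B ¬div = contradiction (refl , refl) ¬div

  step-addCopies : ∀ m x t → ¬ Diverges x t → step x (addCopies m t) ≡ map₁ (addCopies m) (step x t)
  step-addCopies m x (split S c B) ¬div with <-cmp x a
  ... | tri< x<a _ _ = afterSmall-addCopies m (rowInsert x S) c B (λ (e , c≡0) → ¬div (x<a , e , c≡0))
  ... | tri≈ _ _ _   = refl
  ... | tri> _ _ _   = refl

  run-addCopies : ∀ m {t v} → NeverDiverges t v → run (addCopies m t) v ≡ addCopies m (run t v)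
  run-addCopies m []                      = refl
  run-addCopies m {t} {x ∷ v} (¬div ∷ nd) =
    trans (cong (λ p → run (proj₁ p) v) (step-addCopies m x t ¬div)) (run-addCopies m nd)

  bumped-addCopies : ∀ m {t v} → NeverDiverges t v → bumped (addCopies m t) v ≡ bumped t v
  bumped-addCopies m []                      = refl
  bumped-addCopies m {t} {x ∷ v} (¬div ∷ nd) =
    trans (cong (λ p → fromMaybe (proj₂ p) ++ bumped (proj₁ p) v) (step-addCopies m x t ¬div))
          (cong (fromMaybe (proj₂ (step x t)) ++_) (bumped-addCopies m nd))

  Lagging : ℕ → Split → Split → Set
  Lagging m t t′ = small t ≡ small t′ × count t′ < count t + m

  afterSmall-Lagging : ∀ m .{{_ : NonZero m}} p c B c′ B′ → c′ < c + m →
                       Lagging m (proj₁ (afterSmall p c B)) (proj₁ (afterSmall p c′ B′))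
  afterSmall-Lagging m (S , just _)  c       B c′       B′ c′<c+m       = refl , c′<c+m
  afterSmall-Lagging m (S , nothing) (suc c) B (suc c′) B′ (s<s c′<c+m) = refl , c′<c+m
  afterSmall-Lagging m (S , nothing) (suc c) B zero     B′ _            =
    refl , <-≤-trans (>-nonZero⁻¹ m) (m≤n+m m c)
  afterSmall-Lagging m (S , nothing) zero    B (suc c′) B′ c′<m         = refl , <-trans (n<1+n c′) c′<m
  afterSmall-Lagging m (S , nothing) zero    B zero     B′ _            = refl , >-nonZero⁻¹ m

  step-Lagging : ∀ m .{{_ : NonZero m}} x {t t′} → Lagging m t t′ →
                 Lagging m (proj₁ (step x t)) (proj₁ (step x t′))
  step-Lagging m x {split S c B} {split .S c′ B′} (refl , c′<c+m) with <-cmp x a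
  ... | tri< _ _ _ = afterSmall-Lagging m (rowInsert x S) c B c′ B′ c′<c+m
  ... | tri≈ _ _ _ = refl , s<s c′<c+m
  ... | tri> _ _ _ = refl , c′<c+m

  run-Lagging : ∀ m .{{_ : NonZero m}} v {t t′} → Lagging m t t′ → Lagging m (run t v) (run t′ v)
  run-Lagging m []      lag = lag
  run-Lagging m (x ∷ v) lag = run-Lagging m v (step-Lagging m x lag)

  Diverges⇒Lagging : ∀ m .{{_ : NonZero m}} x t → Diverges x t →
                     Lagging m (proj₁ (step x t)) (proj₁ (step x (addCopies m t)))
  Diverges⇒Lagging (suc m) x (split S .0 B) (x<a , e , refl) with <-cmp x a
  ... | tri< _ _ _   =
    subst (λ b → Lagging (suc m) (proj₁ (afterSmall (S′ , b) 0 B)) (proj₁ (afterSmall (S′ , b) (suc m) B)))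
          (sym e) (refl , n<1+n m)
    where S′ = proj₁ (rowInsert x S)
  ... | tri≈ x≮a _ _ = contradiction x<a x≮a
  ... | tri> x≮a _ _ = contradiction x<a x≮a

  NeverDiverges⊎Lagging : ∀ m .{{_ : NonZero m}} v t →
                          NeverDiverges t v ⊎ Lagging m (run t v) (run (addCopies m t) v)
  NeverDiverges⊎Lagging m []      t = inj₁ []
  NeverDiverges⊎Lagging m (x ∷ v) t with diverges? x t
  ... | yes div  = inj₂ (run-Lagging m v (Diverges⇒Lagging m x t div))
  ... | no  ¬div = Sum.map (¬div ∷_) (subst (λ t′ → Lagging m (run t₁ v) (run t′ v)) padded-step)
                           (NeverDiverges⊎Lagging m v t₁)
    where
    t₁ = proj₁ (step x t)
    padded-step : addCopies m t₁ ≡ proj₁ (step x (addCopies m t))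
    padded-step = sym (cong proj₁ (step-addCopies m x t ¬div))

  row-addCopies≡⇒large≡[] : ∀ m t → row (addCopies (suc m) t) ≡ row (run t (replicate (suc m) a)) →
                            large t ≡ []
  row-addCopies≡⇒large≡[] m (split S c B) e =
    ≡drop-suc⇒[] m B (++-cancelˡ (replicate (c + suc m) a) _ _ (++-cancelˡ S _ _ rows))
    where rows = trans e (cong row (run-replicate (suc m) S c B))

  Lagging⇒row≢ : ∀ m {t t′} → WellSplit t → WellSplit t′ → Lagging m t t′ →
                 row t′ ≢ row (run t (replicate m a))
  Lagging⇒row≢ m {split S c B} {split .S c′ B′} (_ , a<B) (_ , a<B′) (refl , c′<c+m) e =
    <-irrefl (replicate-++-injective c′ (c + m) a<B′ (drop⁺ m a<B) (++-cancelˡ S _ _ rows)) c′<c+m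
    where rows = trans e (cong row (run-replicate m S c B))

  Commutes : Word → Set
  Commutes w = NeverDiverges t₀ w × large (run t₀ w) ≡ []

  Commutes⇒∈C : ∀ m w → Commutes w → w ∈C replicate (suc m) a
  Commutes⇒∈C m w (nd , large≡[]) = begin
    P (u ++ w)
      ≡⟨ P-replicate-++ m w ⟩
    row (run (addCopies M t₀) w) ∷ P (bumped (addCopies M t₀) w)
      ≡⟨ cong₂ (λ t v → row t ∷ P v) (run-addCopies M nd) (bumped-addCopies M nd) ⟩
    row (addCopies M tw) ∷ P (bumped t₀ w)
      ≡⟨ cong₂ (λ t v → row t ∷ P v) (sym run-u) (sym bumped-u) ⟩
    row (run tw u) ∷ P (bumped t₀ w ++ bumped tw u)
      ≡⟨ sym (P-++-replicate m w) ⟩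
    P (w ++ u) ∎
    where
    M = suc m
    u = replicate M a
    tw = run t₀ w
    run-u : run tw u ≡ addCopies M tw
    run-u = proj₁ (large≡[]⇒run-replicate M large≡[])
    bumped-u : bumped t₀ w ++ bumped tw u ≡ bumped t₀ w
    bumped-u = trans (cong (bumped t₀ w ++_) (proj₂ (large≡[]⇒run-replicate M large≡[]))) (++-identityʳ _)

  ∈C⇒Commutes : ∀ m w → w ∈C replicate (suc m) a → Commutes w
  ∈C⇒Commutes m w w∈C = from-runs (NeverDiverges⊎Lagging (suc m) w t₀)
    where
    tw = run t₀ w
    first-rows : row (run (addCopies (suc m) t₀) w) ≡ row (run tw (replicate (suc m) a))
    first-rows = ∷-injectiveˡ (trans (sym (P-replicate-++ m w)) (trans w∈C (P-++-replicate m w)))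
    from-runs : NeverDiverges t₀ w ⊎ Lagging (suc m) tw (run (addCopies (suc m) t₀) w) → Commutes w
    from-runs (inj₁ nd)  =
      nd , row-addCopies≡⇒large≡[] m tw (trans (sym (cong row (run-addCopies (suc m) nd))) first-rows)
    from-runs (inj₂ lag) =
      contradiction first-rows (Lagging⇒row≢ (suc m) (run-WellSplit w t₀ ([] , [])) (run-WellSplit w _ ([] , [])) lag)

  ∈C-replicate⇔Commutes : ∀ m w → w ∈C replicate (suc m) a ⇔ Commutes w
  ∈C-replicate⇔Commutes m w = mk⇔ (∈C⇒Commutes m w) (Commutes⇒∈C m w)

open FirstRow using (∈C-replicate⇔Commutes)

corollary2p2 : (a n : ℕ) → 1 ≤ a → 1 ≤ n →
    (k : ℕ) → 1 ≤ k →
    (w : Word) → Positive w →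
      (w ∈C ((([ a ] ^ʷ n)) ^ʷ k)) ⇔ (w ∈C ([ a ] ^ʷ n))
corollary2p2 a (suc n) _ (s≤s z≤n) (suc k) (s≤s z≤n) w _ =
  subst₂ (λ u v → w ∈C u ⇔ w ∈C v) (sym aⁿᵏ) (sym aⁿ)
    (⇔.trans (∈C-replicate⇔Commutes a (n + k * suc n) w) (⇔.sym (∈C-replicate⇔Commutes a n w)))
  where
  aⁿ : [ a ] ^ʷ suc n ≡ replicate (suc n) a
  aⁿ = singleton-^ʷ a (suc n)
  aⁿᵏ : ([ a ] ^ʷ suc n) ^ʷ suc k ≡ replicate (suc k * suc n) a
  aⁿᵏ = trans (cong (_^ʷ suc k) aⁿ) (replicate-^ʷ a (suc n) (suc k))
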